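{- The absolute random order ratio of Best Fit satisfies $RR_{\mathrm{BF}} \ge 1.30$.
   Context: Bin packing: a list of items with sizes in $(0,1]$ must be assigned to unit-capacity bins so that each bin's total size is at most $1$. $\mathrm{OPT}(I)$ is the minimum number of bins needed to pack $I$. Best Fit ($\mathrm{BF}$) is the online algorithm that processes items in list order and packs the current item into the fullest already-open bin in which it fits, opening a new bin if it fits in none; $\mathrm{BF}(I)$ denotes the number of bins it uses on list $I$. For a list $I=(x_1,\ldots,x_n)$ and $\sigma\in\mathcal{S}_n$, $I^\sigma=(x_{\sigma(1)},\ldots,x_{\sigma(n)})$. With $\mathcal{I}$ the set of all finite item lists and $\sigma$ uniform on $\mathcal{S}_n$, the absolute random order ratio is $RR_{\mathrm{BF}}=\sup_{I\in\mathcal{I}}\mathbb{E}[\mathrm{BF}(I^\sigma)]/\mathrm{OPT}(I)$. -}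

module Defs where

open import Data.Nat as ℕ using (ℕ; zero; suc)
open import Data.Nat using (_!)
open import Data.Integer using (+_)
open import Data.Rational using (ℚ; 0ℚ; 1ℚ; _+_; _*_; _-_; _≤_; _<_; _/_)
open import Data.Rational.Properties using (_≤?_; _≟_)
open import Data.List using (List; []; _∷_; _++_; [_]; length; map; foldl; concatMap; filter; allFin; lookup)
open import Data.Fin as Fin using (Fin)
open import Data.Nat.ListAction using (sum)
open import Data.Maybe using (Maybe; nothing; just)
open import Data.Product using (Σ; _×_)
open import Relation.Nullary using (¬_; yes; no)

ValidItem : ℚ → Set
ValidItem x = (0ℚ < x) × (x ≤ 1ℚ)

bestLoad : ℚ → List ℚ → Maybe ℚ
bestLoad x [] = nothing
bestLoad x (l ∷ ls) with l + x ≤? 1ℚ | bestLoad x ls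
... | no _  | r = r
... | yes _ | nothing = just l
... | yes _ | just m with m ≤? l
...   | yes _ = just l
...   | no _  = just m

addTo : ℚ → ℚ → List ℚ → List ℚ
addTo m x [] = []
addTo m x (l ∷ ls) with l ≟ m
... | yes _ = (l + x) ∷ ls
... | no _  = l ∷ addTo m x ls

bfStep : List ℚ → ℚ → List ℚ
bfStep loads x with bestLoad x loads
... | nothing = loads ++ [ x ]
... | just m  = addTo m x loads

BF : List ℚ → ℕ
BF I = length (foldl bfStep [] I)

-- All n! orderings I^σ of a list (one entry per σ ∈ S_n, with repetitions).

insertions : {A : Set} → A → List A → List (List A)
insertions x [] = [ x ∷ [] ]
insertions x (y ∷ ys) = (x ∷ y ∷ ys) ∷ map (y ∷_) (insertions x ys)

perms : {A : Set} → List A → List (List A)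
perms [] = [ [] ]
perms (x ∷ xs) = concatMap (insertions x) (perms xs)

-- Σ_{σ ∈ S_n} BF(I^σ)  (so E[BF(I^σ)] = this / n!)
totalBF : List ℚ → ℕ
totalBF I = sum (map BF (perms I))

binLoad : (I : List ℚ) {k : ℕ} → (Fin (length I) → Fin k) → Fin k → ℚ
binLoad I f b = Data.List.foldr _+_ 0ℚ
  (map (lookup I) (filter (λ i → f i Fin.≟ b) (allFin (length I))))

Packable : List ℚ → ℕ → Set
Packable I k = Σ (Fin (length I) → Fin k) λ f → (b : Fin k) → binLoad I f b ≤ 1ℚ

IsOPT : List ℚ → ℕ → Set
IsOPT I k = Packable I k × ((j : ℕ) → j ℕ.< k → ¬ Packable I j)

ℕtoℚ : ℕ → ℚ
ℕtoℚ n = + n / 1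

-- On I = (3/10, 3/10, 3/10, 1/2, 1/2) the optimum is two bins, {3/10, 3/10, 3/10} and
-- {1/2, 1/2}, since the total size 19/10 exceeds 1.  Best Fit needs a third bin whenever
-- it puts a 1/2 together with a 3/10, which happens in 72 of the 120 orders; so
-- E[BF(I^σ)] = (2·48 + 3·72)/120 = 13/5 = (13/10)·OPT(I).
module Submission where

open import Defs
open import Data.Nat as ℕ using (ℕ)
open import Data.Nat using (_!)
open import Data.Integer using (+_)
open import Data.Rational using (ℚ; 0ℚ; _-_; _*_; _≤_; _<_; _/_)
open import Data.List using (List; length)
open import Data.List.Relation.Unary.All using (All)
open import Data.Product using (Σ; _×_)

open import Data.Rational using (_+_; 1ℚ; NonNegative)
open import Data.Rational.Properties
  using (_<?_; _≤?_; <-irrefl; <-≤-trans; ≤-trans; ≤-reflexive; <⇒≤;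
         +-monoʳ-≤; +-identityʳ; neg-antimono-≤; *-monoʳ-≤-nonNeg)
open import Data.List using ([]; _∷_; foldr; map; lookup; tabulate; filter; allFin)
open import Data.List.Properties using (filter-all; map-tabulate; tabulate-lookup)
open import Data.List.Relation.Unary.All using ([]; _∷_; universal)
open import Data.Fin as Fin using (Fin; zero; suc)
open import Data.Fin.Properties using (¬Fin0)
open import Data.Product using (_,_)
open import Function using (id; _∘_)
open import Relation.Nullary using (¬_)
open import Relation.Nullary.Decidable using (True; toWitness; from-yes)
open import Relation.Binary.PropositionalEquality using (_≡_; refl; sym; cong; trans; subst; module ≡-Reasoning)

totalSize : List ℚ → ℚ
totalSize = foldr _+_ 0ℚ

Fin1-≡zero : (i : Fin 1) → i ≡ zero
Fin1-≡zero zero = refl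

binLoad-single : (I : List ℚ) (f : Fin (length I) → Fin 1) → binLoad I f zero ≡ totalSize I
binLoad-single I f = begin
  totalSize (map (lookup I) (filter (λ i → f i Fin.≟ zero) (allFin (length I))))
    ≡⟨ cong (totalSize ∘ map (lookup I)) everyIndexSelected ⟩
  totalSize (map (lookup I) (tabulate id))
    ≡⟨ cong totalSize (trans (map-tabulate id (lookup I)) (tabulate-lookup I)) ⟩
  totalSize I ∎
  where
  open ≡-Reasoning
  everyIndexSelected = filter-all (λ i → f i Fin.≟ zero) (universal (Fin1-≡zero ∘ f) (allFin (length I)))

¬Packable-zero : ∀ {x I} → ¬ Packable (x ∷ I) 0
¬Packable-zero (f , _) = ¬Fin0 (f zero)

¬Packable-one : ∀ {I} → 1ℚ < totalSize I → ¬ Packable I 1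
¬Packable-one {I} 1<size (f , fits) =
  <-irrefl refl (<-≤-trans 1<size (subst (_≤ 1ℚ) (binLoad-single I f) (fits zero)))

isOPT-two : ∀ {x I} → Packable (x ∷ I) 2 → 1ℚ < totalSize (x ∷ I) → IsOPT (x ∷ I) 2
isOPT-two packing 1<size = packing , λ where
  0 _ → ¬Packable-zero
  1 _ → ¬Packable-one 1<size
  (ℕ.suc (ℕ.suc _)) (ℕ.s≤s (ℕ.s≤s ()))

sub-*-monoˡ-≤ : ∀ p q .{{_ : NonNegative q}} {ε} → 0ℚ < ε → (p - ε) * q ≤ p * q
sub-*-monoˡ-≤ p q {ε} 0<ε = *-monoʳ-≤-nonNeg q p-ε≤p
  where
  p-ε≤p : p - ε ≤ p
  p-ε≤p = subst (p - _ ≤_) (+-identityʳ p) (+-monoʳ-≤ p (neg-antimono-≤ (<⇒≤ 0<ε)))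

validItem : (x : ℚ) → {True (0ℚ <? x)} → {True (x ≤? 1ℚ)} → ValidItem x
validItem x {0<x} {x≤1} = toWitness 0<x , toWitness x≤1

small large : ℚ
small = + 3 / 10
large = + 1 / 2

worstList : List ℚ
worstList = small ∷ small ∷ small ∷ large ∷ large ∷ []

worstList-valid : All ValidItem worstList
worstList-valid =
  validItem small ∷ validItem small ∷ validItem small ∷ validItem large ∷ validItem large ∷ []

worstList-packable : Packable worstList 2
worstList-packable = bySize , λ where
    zero → from-yes (binLoad worstList bySize zero ≤? 1ℚ)
    (suc zero) → from-yes (binLoad worstList bySize (suc zero) ≤? 1ℚ)
  where
  bySize : Fin 5 → Fin 2
  bySize zero = zero
  bySize (suc zero) = zero
  bySize (suc (suc zero)) = zero
  bySize _ = suc zero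

worstList-OPT : IsOPT worstList 2
worstList-OPT = isOPT-two worstList-packable (from-yes (1ℚ <? totalSize worstList))

-- Checked by running Best Fit on all 5! = 120 orders: totalBF worstList = 312.
totalBF-worstList : ℕtoℚ (totalBF worstList) ≡ (+ 13 / 10) * ℕtoℚ (2 ℕ.* (5 !))
totalBF-worstList = refl

theorem5 : (ε : ℚ) → 0ℚ < ε →
    Σ (List ℚ) λ I → All ValidItem I × (0 ℕ.< length I) ×
      Σ ℕ λ k → IsOPT I k ×
        (((+ 13 / 10) - ε) * ℕtoℚ (k ℕ.* (length I !)) ≤ ℕtoℚ (totalBF I))
theorem5 ε 0<ε = worstList , worstList-valid , ℕ.s≤s ℕ.z≤n , 2 , worstList-OPT ,
  ≤-trans (sub-*-monoˡ-≤ (+ 13 / 10) (ℕtoℚ 240) 0<ε) (≤-reflexive (sym totalBF-worstList))
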